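{- Let $m>0$ and let $R$ be a relation on a set $X$. Then $R^{[m]}\subseteq\bigcup_{l<\omega}R^{ml+1}$.
   Context: $R^0=Id_X$ (diagonal), $R^{i+1}=R\circ R^i$. Define $R^{[m]}_0=R$, $R^{[m]}_{n+1}=\left(\bigcup_{i\le n}R^{[m]}_i\right)^{m+1}\setminus Id_X$, and $R^{[m]}=\bigcup_{n<\omega}R^{[m]}_n$. -}

module Defs where

import Level
open import Data.Nat using (ℕ; zero; suc; _≤_)
open import Data.Sum using (_⊎_)
open import Data.Product using (Σ; _×_; ∃; ∃-syntax)
open import Relation.Binary.PropositionalEquality using (_≡_)
open import Relation.Nullary using (¬_)

Rel : ∀ {ℓ} → Set ℓ → Set (Level.suc ℓ)
Rel {ℓ} X = X → X → Set ℓ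

Id : ∀ {ℓ} (X : Set ℓ) → Rel X
Id X x y = x ≡ y

-- Composition: (R ∘ S) x y iff ∃ z, S x z and R z y  (first S, then R).
_∘ᴿ_ : ∀ {ℓ} {X : Set ℓ} → Rel X → Rel X → Rel X
(R ∘ᴿ S) x y = ∃[ z ] (S x z × R z y)

_^ᴿ_ : ∀ {ℓ} {X : Set ℓ} → Rel X → ℕ → Rel X
_^ᴿ_ {X = X} R zero = Id X
R ^ᴿ suc i = R ∘ᴿ (R ^ᴿ i)

_∖Id : ∀ {ℓ} {X : Set ℓ} → Rel X → Rel X
(R ∖Id) x y = R x y × ¬ (x ≡ y)

_∪ᴿ_ : ∀ {ℓ} {X : Set ℓ} → Rel X → Rel X → Rel X
(R ∪ᴿ S) x y = R x y ⊎ S x y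

-- U m R n = ⋃_{i ≤ n} R^[m]_i, defined by recursion on n:
-- U 0 = R^[m]_0 = R,  U (n+1) = U n ∪ R^[m]_{n+1},
-- where R^[m]_{n+1} = (U n)^{m+1} \ Id_X.
stageUpTo : ∀ {ℓ} {X : Set ℓ} → ℕ → Rel X → ℕ → Rel X
stageUpTo m R zero = R
stageUpTo m R (suc n) = stageUpTo m R n ∪ᴿ ((stageUpTo m R n ^ᴿ suc m) ∖Id)

stage : ∀ {ℓ} {X : Set ℓ} → ℕ → Rel X → ℕ → Rel X
stage m R zero = R
stage m R (suc n) = (stageUpTo m R n ^ᴿ suc m) ∖Id

bracket : ∀ {ℓ} {X : Set ℓ} → ℕ → Rel X → Rel X
bracket m R x y = ∃[ n ] stage m R n x y

-- The relation ⋃_l R^(ml+1), i.e. R-paths of length ≡ 1 (mod m), contains R and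
-- is closed under (m+1)-fold composition: m+1 such paths chain to a path of
-- length ≡ m+1 ≡ 1 (mod m). By induction on n it therefore contains every
-- ⋃_{i≤n} R^[m]_i. The argument never uses m > 0.
module Submission where

open import Defs
open import Data.Nat using (ℕ; zero; suc; _*_; _+_; _>_)
open import Data.Nat.Properties using (*-zeroʳ)
open import Data.Nat.Tactic.RingSolver using (solve-∀)
open import Data.Sum using (inj₁; inj₂)
open import Data.Product using (∃-syntax; _,_)
open import Relation.Binary.Core using (_⇒_)
open import Relation.Binary.PropositionalEquality using (_≡_; refl; subst; sym)

module _ {ℓ} {X : Set ℓ} where

  ^ᴿ-mono : {R S : Rel X} → R ⇒ S → ∀ k → R ^ᴿ k ⇒ S ^ᴿ k
  ^ᴿ-mono R⇒S zero    refl        = refl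
  ^ᴿ-mono R⇒S (suc k) (z , p , r) = z , ^ᴿ-mono R⇒S k p , R⇒S r

  ^ᴿ-+ : {R : Rel X} → ∀ a b → (R ^ᴿ b) ∘ᴿ (R ^ᴿ a) ⇒ R ^ᴿ (b + a)
  ^ᴿ-+ a zero    (_ , p , refl)        = p
  ^ᴿ-+ a (suc b) (z , p , (w , q , r)) = w , ^ᴿ-+ a b (z , p , q) , r

module _ {ℓ} {X : Set ℓ} (m : ℕ) (R : Rel X) where

  PowMod : ℕ → Rel X
  PowMod k x y = ∃[ L ] (R ^ᴿ (m * L + k)) x y

  ^ᴿ⇒PowMod : ∀ k → R ^ᴿ k ⇒ PowMod k
  ^ᴿ⇒PowMod k {x} {y} p = 0 , subst (λ j → (R ^ᴿ (j + k)) x y) (sym (*-zeroʳ m)) p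

  PowMod-+ : ∀ a b → PowMod b ∘ᴿ PowMod a ⇒ PowMod (b + a)
  PowMod-+ a b {x} {y} (z , (L , p) , (L′ , q)) =
    L′ + L , subst (λ j → (R ^ᴿ j) x y) (length≡ m a b L L′) (^ᴿ-+ (m * L + a) (m * L′ + b) (z , p , q))
    where
    length≡ : ∀ n c d K K′ → n * K′ + d + (n * K + c) ≡ n * (K′ + K) + (d + c)
    length≡ = solve-∀

  PowMod-reduce : ∀ k → PowMod (k + m) ⇒ PowMod k
  PowMod-reduce k {x} {y} (L , p) = suc L , subst (λ j → (R ^ᴿ j) x y) (length≡ m k L) p
    where
    length≡ : ∀ n c K → n * K + (c + n) ≡ n * suc K + c
    length≡ = solve-∀

  PowMod1-^ᴿ : ∀ k → PowMod 1 ^ᴿ k ⇒ PowMod k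
  PowMod1-^ᴿ zero    refl        = ^ᴿ⇒PowMod 0 refl
  PowMod1-^ᴿ (suc k) (z , p , q) = PowMod-+ k 1 (z , PowMod1-^ᴿ k p , q)

  stageUpTo⇒PowMod1 : ∀ n → stageUpTo m R n ⇒ PowMod 1
  stageUpTo⇒PowMod1 zero    r              = ^ᴿ⇒PowMod 1 (_ , refl , r)
  stageUpTo⇒PowMod1 (suc n) (inj₁ u)       = stageUpTo⇒PowMod1 n u
  stageUpTo⇒PowMod1 (suc n) (inj₂ (u , _)) =
    PowMod-reduce 1 (PowMod1-^ᴿ (suc m) (^ᴿ-mono (stageUpTo⇒PowMod1 n) (suc m) u))

  stage⇒stageUpTo : ∀ n → stage m R n ⇒ stageUpTo m R n
  stage⇒stageUpTo zero    r = r
  stage⇒stageUpTo (suc n) r = inj₂ r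

proposition14 : ∀ {ℓ} {X : Set ℓ} (m : ℕ) → m > 0 → (R : Rel X) →
    ∀ x y → bracket m R x y → ∃[ l ] ((R ^ᴿ (m * l + 1)) x y)
proposition14 m _ R x y (n , r) = stageUpTo⇒PowMod1 m R n (stage⇒stageUpTo m R n r)
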